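{- Let $B$ be a $\wedge_d$-FBDD and $u$ a node of $B$. Let $x\in Var(B_u)$ and $a\in\{0,1\}$, and assume there is $\mathbf h\in\mathcal S(B_u)$ with $\mathbf h(x)=a$. Let $y\in Var(B)\setminus Var(B_u)$, $b\in\{0,1\}$, and let $\mathbf g\in\mathcal S(B)$ be an assignment carried through $u$ with $\mathbf g(y)=b$. Then $f(B)$ has a satisfying assignment assigning $x$ to $a$ and $y$ to $b$.
   Context: A $\wedge_d$-FBDD is a DAG $B$ with one source and at most two sinks; non-sink nodes have two children; sinks labelled $True$/$False$ (one of each if two); non-sink nodes labelled by a variable (out-edges labelled $0$,$1$) or by $\wedge$. $B_u$ is the sub-DAG of nodes reachable from $u$; $Var(B_u)$ its labelling variables. Read-once: no directed path repeats a variable. Decomposable: children $u_1,u_2$ of a $\wedge$-node satisfy $Var(B_{u_1})\cap Var(B_{u_2})=\emptyset$. Semantics $\mathcal S(B)$ over $Var(B)$: $\{\emptyset\}$ for $True$ sink, $\emptyset$ for $False$ sink; source labelled $x$, $0$-child $u_0$, $1$-child $u_1$: $\{(x,0)\}\times\mathcal S(B_{u_0})\times\{0,1\}^{Var(B_{u_1})\setminus Var(B_{u_0})}\cup\{(x,1)\}\times\mathcal S(B_{u_1})\times\{0,1\}^{Var(B_{u_0})\setminus Var(B_{u_1})}$; $\wedge$ source: $\mathcal S(B_{u_0})\times\mathcal S(B_{u_1})$ where $\mathcal H_1\times\mathcal H_2=\{\mathbf a\cup\mathbf b\}$. $f(B)$ is the function whose satisfying assignments are $\mathcal S(B)$. A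 target path is a directed path $P$ from the source, $u(P)$ its last node, and $\mathbf a(P)$ the assignment mapping each variable $x$ labelling a node of $P$ other than $u(P)$ to the label of the edge of $P$ leaving that node. An assignment $\mathbf g$ of $Var(B)$ is carried through $u$ if there is a target path $P$ with $u(P)=u$ and $\mathbf a(P)\subseteq\mathbf g$. -}

module Defs where

open import Data.Nat using (ℕ)
open import Data.Fin using (Fin)
open import Data.Bool using (Bool; true; false)
open import Data.Product using (_×_; Σ; ∃-syntax)
open import Data.Empty using (⊥)
open import Relation.Nullary using (¬_)
open import Relation.Binary.PropositionalEquality using (_≡_)

-- A node label records the kind of
-- node together with its (ordered) children: for a variable node the first
-- child is the 0-child and the second the 1-child.
data NodeLabel (m n : ℕ) : Set where
  sink    : Bool → NodeLabel m n
  varNode : Fin m → Fin n → Fin n → NodeLabel m n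
  andNode : Fin n → Fin n → NodeLabel m n

module _ {m n : ℕ} (lab : Fin n → NodeLabel m n) where

  data Edge : Fin n → Fin n → Set where
    e0  : ∀ {i x c₀ c₁} → lab i ≡ varNode x c₀ c₁ → Edge i c₀
    e1  : ∀ {i x c₀ c₁} → lab i ≡ varNode x c₀ c₁ → Edge i c₁
    eˡ  : ∀ {i c₀ c₁} → lab i ≡ andNode c₀ c₁ → Edge i c₀
    eʳ  : ∀ {i c₀ c₁} → lab i ≡ andNode c₀ c₁ → Edge i c₁

  data Reach⁺ : Fin n → Fin n → Set where
    step : ∀ {i j} → Edge i j → Reach⁺ i j
    _∷_  : ∀ {i j k} → Edge i j → Reach⁺ j k → Reach⁺ i k

  LabelledBy : Fin n → Fin m → Set
  LabelledBy i x = Σ (Fin n) λ c₀ → Σ (Fin n) λ c₁ → lab i ≡ varNode x c₀ c₁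

  data Occurs (x : Fin m) : Fin n → Set where
    here  : ∀ {u} → LabelledBy u x → Occurs x u
    there : ∀ {u v} → Edge u v → Occurs x v → Occurs x u

  IsSource : Fin n → Set
  IsSource i = ∀ j → ¬ Edge j i

  IsSink : Fin n → Bool → Set
  IsSink i β = lab i ≡ sink β

  -- Assignments are total maps g : Fin m → Bool; 'InS u g'
  -- states that the restriction of g to Var(B_u) belongs to S(B_u)
  -- (the factor {0,1}^{...} in the definition of S makes the variables
  -- outside the chosen branch free, which is exactly this restriction reading).
  data InS (g : Fin m → Bool) : Fin n → Set where
    sinkT : ∀ {u} → lab u ≡ sink true → InS g u
    var0  : ∀ {u x c₀ c₁} → lab u ≡ varNode x c₀ c₁ → g x ≡ false → InS g c₀ → InS g u
    var1  : ∀ {u x c₀ c₁} → lab u ≡ varNode x c₀ c₁ → g x ≡ true  → InS g c₁ → InS g u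
    and∧  : ∀ {u c₀ c₁} → lab u ≡ andNode c₀ c₁ → InS g c₀ → InS g c₁ → InS g u

  -- A target path from v ending at u whose assignment a(P) is contained in g
  -- (only variable nodes other than the last node constrain g).
  data CarriedPath (g : Fin m → Bool) (u : Fin n) : Fin n → Set where
    end  : CarriedPath g u u
    via0 : ∀ {v x c₀ c₁} → lab v ≡ varNode x c₀ c₁ → g x ≡ false → CarriedPath g u c₀ → CarriedPath g u v
    via1 : ∀ {v x c₀ c₁} → lab v ≡ varNode x c₀ c₁ → g x ≡ true  → CarriedPath g u c₁ → CarriedPath g u v
    viaˡ : ∀ {v c₀ c₁} → lab v ≡ andNode c₀ c₁ → CarriedPath g u c₀ → CarriedPath g u v
    viaʳ : ∀ {v c₀ c₁} → lab v ≡ andNode c₀ c₁ → CarriedPath g u c₁ → CarriedPath g u v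

record AndDFBDD (m n : ℕ) : Set where
  field
    lab          : Fin n → NodeLabel m n
    source       : Fin n
    acyclic      : ∀ i → ¬ Reach⁺ lab i i
    source-src   : IsSource lab source
    source-uniq  : ∀ i → IsSource lab i → i ≡ source
    -- at most two sinks, and if two then one True and one False
    sinks        : ∀ i j β → IsSink lab i β → IsSink lab j β → i ≡ j
    read-once    : ∀ i j x → LabelledBy lab i x → Reach⁺ lab i j → LabelledBy lab j x → ⊥
    decomposable : ∀ u c₀ c₁ x → lab u ≡ andNode c₀ c₁ → Occurs lab x c₀ → Occurs lab x c₁ → ⊥

  Var : Fin n → Fin m → Set
  Var u x = Occurs lab x u

  Sat : Fin n → (Fin m → Bool) → Set
  Sat u g = InS lab g u

  CarriedThrough : (Fin m → Bool) → Fin n → Set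
  CarriedThrough g u = CarriedPath lab g u source

module Submission where

open import Defs
open import Data.Nat using (ℕ)
open import Data.Fin using (Fin)
open import Data.Fin.Properties using () renaming (_≟_ to _≟ᶠ_)
open import Data.Bool using (Bool; true; false)
open import Data.Product using (_×_; Σ; _,_)
open import Data.List using (List; []; _∷_; _++_)
open import Data.List.Membership.Propositional using (_∈_; _∉_)
open import Data.List.Membership.Propositional.Properties using (∈-++⁻; ∈-++⁺ˡ; ∈-++⁺ʳ)
open import Data.List.Relation.Unary.Any using (here; there)
open import Data.Sum using (inj₁; inj₂)
open import Function using (_∘_)
open import Relation.Nullary using (¬_; yes; no; contradiction)
open import Relation.Binary.Definitions using (DecidableEquality)
open import Relation.Binary.PropositionalEquality using (_≡_; refl; sym; trans)
import Data.List.Membership.DecPropositional as DecMembership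

-- Idea: outside Var(B_u), keep g; on Var(B_u), switch to h.  Along the
-- carried path from the source to u, read-once guarantees that the variables
-- tested on the path are untouched, and decomposability guarantees that the
-- sibling branches of ∧-nodes on the path avoid Var(B_u); so the derivation
-- of g ∈ S(B) survives with the subderivation at u replaced by that of h.

module Override {a} {A : Set a} (_≟_ : DecidableEquality A) where
  open DecMembership _≟_ using (_∈?_)

  override : List A → (A → Bool) → (A → Bool) → A → Bool
  override L h g z with z ∈? L
  ... | yes _ = h z
  ... | no  _ = g z

  override-∈ : ∀ {L h g z} → z ∈ L → override L h g z ≡ h z
  override-∈ {L} {z = z} z∈L with z ∈? L
  ... | yes _   = refl
  ... | no  z∉L = contradiction z∈L z∉L

  override-∉ : ∀ {L h g z} → z ∉ L → override L h g z ≡ g z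
  override-∉ {L} {z = z} z∉L with z ∈? L
  ... | yes z∈L = contradiction z∈L z∉L
  ... | no  _   = refl

module _ {m n : ℕ} (lab : Fin n → NodeLabel m n) where

  support : ∀ {g v} → InS lab g v → List (Fin m)
  support (sinkT _)              = []
  support (var0 {x = x} _ _ d)   = x ∷ support d
  support (var1 {x = x} _ _ d)   = x ∷ support d
  support (and∧ _ d₀ d₁)         = support d₀ ++ support d₁

  support-Occurs : ∀ {g v z} (d : InS lab g v) → z ∈ support d → Occurs lab z v
  support-Occurs (var0 p _ d) (here refl) = here (_ , _ , p)
  support-Occurs (var0 p _ d) (there z∈) = there (e0 p) (support-Occurs d z∈)
  support-Occurs (var1 p _ d) (here refl) = here (_ , _ , p)
  support-Occurs (var1 p _ d) (there z∈) = there (e1 p) (support-Occurs d z∈)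
  support-Occurs (and∧ p d₀ d₁) z∈ with ∈-++⁻ (support d₀) z∈
  ... | inj₁ z∈₀ = there (eˡ p) (support-Occurs d₀ z∈₀)
  ... | inj₂ z∈₁ = there (eʳ p) (support-Occurs d₁ z∈₁)

  InS-cong : ∀ {g g′ v} (d : InS lab g v) → (∀ {z} → z ∈ support d → g′ z ≡ g z) → InS lab g′ v
  InS-cong (sinkT s)      agree = sinkT s
  InS-cong (var0 p q d)   agree = var0 p (trans (agree (here refl)) q) (InS-cong d (λ z∈ → agree (there z∈)))
  InS-cong (var1 p q d)   agree = var1 p (trans (agree (here refl)) q) (InS-cong d (λ z∈ → agree (there z∈)))
  InS-cong (and∧ p d₀ d₁) agree =
    and∧ p (InS-cong d₀ (λ z∈ → agree (∈-++⁺ˡ z∈)))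
           (InS-cong d₁ (λ z∈ → agree (∈-++⁺ʳ (support d₀) z∈)))

  InS-child₀ : ∀ {g v x c₀ c₁} → lab v ≡ varNode x c₀ c₁ → g x ≡ false → InS lab g v → InS lab g c₀
  InS-child₀ r q (sinkT s)      = contradiction (trans (sym r) s) λ ()
  InS-child₀ r q (and∧ p _ _)   = contradiction (trans (sym r) p) λ ()
  InS-child₀ r q (var0 p _ d) with trans (sym r) p
  ... | refl = d
  InS-child₀ r q (var1 p q′ _) with trans (sym r) p
  ... | refl = contradiction (trans (sym q) q′) λ ()

  InS-child₁ : ∀ {g v x c₀ c₁} → lab v ≡ varNode x c₀ c₁ → g x ≡ true → InS lab g v → InS lab g c₁
  InS-child₁ r q (sinkT s)      = contradiction (trans (sym r) s) λ ()
  InS-child₁ r q (and∧ p _ _)   = contradiction (trans (sym r) p) λ ()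
  InS-child₁ r q (var1 p _ d) with trans (sym r) p
  ... | refl = d
  InS-child₁ r q (var0 p q′ _) with trans (sym r) p
  ... | refl = contradiction (trans (sym q) q′) λ ()

  InS-children : ∀ {g v c₀ c₁} → lab v ≡ andNode c₀ c₁ → InS lab g v → InS lab g c₀ × InS lab g c₁
  InS-children r (sinkT s)      = contradiction (trans (sym r) s) λ ()
  InS-children r (var0 p _ _)   = contradiction (trans (sym r) p) λ ()
  InS-children r (var1 p _ _)   = contradiction (trans (sym r) p) λ ()
  InS-children r (and∧ p d₀ d₁) with trans (sym r) p
  ... | refl = d₀ , d₁

  CarriedPath-Occurs : ∀ {g u v z} → CarriedPath lab g u v → Occurs lab z u → Occurs lab z v
  CarriedPath-Occurs end          o = o
  CarriedPath-Occurs (via0 r _ P) o = there (e0 r) (CarriedPath-Occurs P o)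
  CarriedPath-Occurs (via1 r _ P) o = there (e1 r) (CarriedPath-Occurs P o)
  CarriedPath-Occurs (viaˡ r P)   o = there (eˡ r) (CarriedPath-Occurs P o)
  CarriedPath-Occurs (viaʳ r P)   o = there (eʳ r) (CarriedPath-Occurs P o)

  Occurs-Reach⁺ : ∀ {v c z} → Edge lab v c → Occurs lab z c
                → Σ (Fin n) λ w → Reach⁺ lab v w × LabelledBy lab w z
  Occurs-Reach⁺ e (here l)     = _ , step e , l
  Occurs-Reach⁺ e (there e′ o) with Occurs-Reach⁺ e′ o
  ... | w , p , l = w , e ∷ p , l

module _ {m n : ℕ} (B : AndDFBDD m n) where
  open AndDFBDD B

  label-not-below : ∀ {v c x} → LabelledBy lab v x → Edge lab v c → ¬ Occurs lab x c
  label-not-below {v} {x = x} l e o with Occurs-Reach⁺ lab e o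
  ... | w , p , l′ = read-once v w x l p l′

  splice : ∀ {g g′ u v} → CarriedPath lab g u v → InS lab g v → InS lab g′ u
         → (∀ {z} → ¬ Var u z → g′ z ≡ g z) → InS lab g′ v
  splice end D E outside = E
  splice (via0 r q P) D E outside =
    var0 r (trans (outside (label-not-below (_ , _ , r) (e0 r) ∘ CarriedPath-Occurs lab P)) q)
           (splice P (InS-child₀ lab r q D) E outside)
  splice (via1 r q P) D E outside =
    var1 r (trans (outside (label-not-below (_ , _ , r) (e1 r) ∘ CarriedPath-Occurs lab P)) q)
           (splice P (InS-child₁ lab r q D) E outside)
  splice {v = v} (viaˡ r P) D E outside with InS-children lab r D
  ... | D₀ , D₁ = and∧ r (splice P D₀ E outside)
    (InS-cong lab D₁ λ z∈ → outside λ o →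
      decomposable v _ _ _ r (CarriedPath-Occurs lab P o) (support-Occurs lab D₁ z∈))
  splice {v = v} (viaʳ r P) D E outside with InS-children lab r D
  ... | D₀ , D₁ = and∧ r
    (InS-cong lab D₀ λ z∈ → outside λ o →
      decomposable v _ _ _ r (support-Occurs lab D₀ z∈) (CarriedPath-Occurs lab P o))
    (splice P D₁ E outside)

lemma4 : ∀ {m n : ℕ} (B : AndDFBDD m n) (u : Fin n) (x : Fin m) (a : Bool)
    → AndDFBDD.Var B u x
    → Σ (Fin m → Bool) (λ h → AndDFBDD.Sat B u h × h x ≡ a)
    → (y : Fin m) (b : Bool)
    → AndDFBDD.Var B (AndDFBDD.source B) y → ¬ AndDFBDD.Var B u y
    → (g : Fin m → Bool)
    → AndDFBDD.Sat B (AndDFBDD.source B) g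
    → AndDFBDD.CarriedThrough B g u
    → g y ≡ b
    → Σ (Fin m → Bool) (λ g′ → AndDFBDD.Sat B (AndDFBDD.source B) g′ × g′ x ≡ a × g′ y ≡ b)
lemma4 B u x a x∈u (h , E , hx) y b _ y∉u g D P gy =
  g′ , splice B P D E′ (λ z∉u → g′-off-L (z∉u ∘ L⊆Var)) ,
  trans (g′-on-L (here refl)) hx , trans (g′-off-L (y∉u ∘ L⊆Var)) gy
  where
  open AndDFBDD B using (lab; Var; Sat)
  open Override _≟ᶠ_

  -- A decidable stand-in for Var(B_u): the variables read by E, and x.
  L : List _
  L = x ∷ support lab E

  g′ : _ → Bool
  g′ = override L h g

  g′-on-L : ∀ {z} → z ∈ L → g′ z ≡ h z
  g′-on-L = override-∈

  g′-off-L : ∀ {z} → z ∉ L → g′ z ≡ g z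
  g′-off-L = override-∉

  L⊆Var : ∀ {z} → z ∈ L → Var u z
  L⊆Var (here refl) = x∈u
  L⊆Var (there z∈)  = support-Occurs lab E z∈

  E′ : Sat u g′
  E′ = InS-cong lab E (g′-on-L ∘ there)
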